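{- Let $d\ge2$, $n\ge0$. For any tree $\mathcal{T}\in\mathbb{T}^{2^{d-1}}_n$ and any compatible tuple ${\bf C}$ of total orders on $\mathbb{F}^d$, there is at most one $d$-permutation $\boldsymbol\pi$ that is admissible with respect to ${\bf C}$ and satisfies $\gamma^d(\boldsymbol\pi)=\mathcal{T}$.
   Context: A $d$-permutation of size $n$ is a tuple $\boldsymbol{\pi}=(\pi_1,\ldots,\pi_{d-1})$ of permutations of $[n]$; put $\pi_0=\mathrm{id}$. Its points are $(i,\pi_1(i),\ldots,\pi_{d-1}(i))$, $i\in[n]$; $\pi_l(p)$ is the $l$-th coordinate of point $p$. For distinct points $p,q$, ${\bf dir}(p,q)=(\mathrm{sign}(\pi_0(q)-\pi_0(p)),\ldots,\mathrm{sign}(\pi_{d-1}(q)-\pi_{d-1}(p)))$. $\mathbb{F}^d$ is the set of the $2^{d-1}$ directions in $\{+1,-1\}^d$ with last entry $-1$. $\mathbb{T}^{2^{d-1}}_n$ is the set of rooted trees with $n$ internal nodes, each node a leaf or internal with exactly $2^{d-1}$ children labelled by the distinct directions of $\mathbb{F}^d$; $\mathcal{T}_{\bf f}(r)$ is the subtree at the child of $r$ labelled ${\bf f}$. Max-tree $\gamma^d(\boldsymbol\pi)$: empty gives a single leaf; otherwise the root corresponds to the point $p_{\max}$ with $\pi_{d-1}(p_{\max})=n$, and the child labelled ${\bf f}$ is the max-tree of the sub-$d$-permutation formed by points $p'$ with ${\bf dir}(p_{\max},p')={\bf f}$ (relabelled order-preservingly). Internal nodes correspond to points. A total order is compatible w.r.t.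 axis $k$ if no direction with $k$-th entry $+1$ precedes one with $k$-th entry $-1$; ${\bf C}=(C_0,\ldots,C_{d-1})$ is compatible if each $C_k$ is compatible w.r.t. axis $k$. $\boldsymbol\pi$ is admissible w.r.t. ${\bf C}$ if for every internal node $r$ of $\gamma^d(\boldsymbol\pi)$, every $l\in\{0,\ldots,d-1\}$ and all ${\bf f}_1,{\bf f}_2\in\mathbb{F}^d$ with ${\bf f}_1$ before ${\bf f}_2$ in $C_l$, every point of a node of $\mathcal{T}_{{\bf f}_1}(r)$ has smaller $l$-th coordinate than every point of a node of $\mathcal{T}_{{\bf f}_2}(r)$. -}

module Defs where

open import Level using (0ℓ)
open import Data.Nat using (ℕ; zero; suc; pred; _+_; _<ᵇ_; _≤_; _<_)
open import Data.Unit using (⊤)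
open import Data.Empty using (⊥)
open import Data.Bool using (Bool; true; false)
open import Data.Fin using (Fin; zero; suc; toℕ; fromℕ)
open import Data.Fin.Permutation using (Permutation′; _⟨$⟩ʳ_)
open import Data.Vec using (Vec; []; _∷_; _∷ʳ_; lookup; tabulate)
open import Data.List using (List; []; _∷_; _++_; map)
open import Data.Product using (_×_)
open import Relation.Binary.PropositionalEquality using (_≡_; _≢_)
open import Relation.Binary.Core using (Rel)
open import Relation.Unary using (Pred)
open import Relation.Nullary using (¬_)

-- d-permutations of size n: a tuple (π_1,…,π_{d-1}) of permutations of
-- [n] (here [n] = Fin n).  π_0 = id is implicit.

record DPerm (d n : ℕ) : Set where
  constructor dperm
  field perm : Fin (pred d) → Permutation′ n
open DPerm public

coord : ∀ {d n} → DPerm d n → Fin d → Fin n → Fin n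
coord {suc d} π zero    i = i
coord {suc d} π (suc l) i = perm π l ⟨$⟩ʳ i

-- Directions in {+1,-1}^d, encoded as Bool vectors (true = +1, false = -1).
Dir : ℕ → Set
Dir d = Vec Bool d

dir : ∀ {d n} → DPerm d n → Fin n → Fin n → Dir d
dir π p q = tabulate (λ l → toℕ (coord π l p) <ᵇ toℕ (coord π l q))

-- 𝔽^d: directions whose last entry is -1.  Encoded by their first d-1
-- entries; toDir appends the final entry -1 (= false).
record Fdir (d : ℕ) : Set where
  constructor fdir
  field firsts : Vec Bool (pred d)
open Fdir public

toDir : ∀ {d} → Fdir d → Dir d
toDir {zero}  f = []
toDir {suc d} f = firsts f ∷ʳ false

entry : ∀ {d} → Fin d → Fdir d → Bool
entry k f = lookup (toDir f) k

data Tree (A : Set) : Set where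
  leaf : Tree A
  node : (A → Tree A) → Tree A

allVecs : ∀ k → List (Vec Bool k)
allVecs zero    = [] ∷ []
allVecs (suc k) = map (true ∷_) (allVecs k) ++ map (false ∷_) (allVecs k)

mutual
  size : ∀ {d} → Tree (Fdir d) → ℕ
  size {d} leaf     = 0
  size {d} (node c) = suc (sizeL c (map fdir (allVecs (pred d))))

  sizeL : ∀ {d} → (Fdir d → Tree (Fdir d)) → List (Fdir d) → ℕ
  sizeL c []       = 0
  sizeL c (v ∷ vs) = size (c v) + sizeL c vs

-- IsMaxTree π S T says: T is the max-tree of the
-- sub-d-permutation of π formed by the points in S (relabelling order-
-- preservingly does not change directions or which point is maximal, so
-- we work with the original coordinates).  γ^d(π) = T  iff
-- IsMaxTree π Full T.

Full : ∀ {n} → Pred (Fin n) 0ℓ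
Full _ = ⊤

childSet : ∀ {d n} → DPerm d n → Pred (Fin n) 0ℓ → Fin n → Fdir d → Pred (Fin n) 0ℓ
childSet π S p f q = S q × (q ≢ p) × (dir π p q ≡ toDir f)

lastCoord : ∀ {d n} → DPerm d n → Fin n → ℕ
lastCoord {zero}  π p = 0
lastCoord {suc d} π p = toℕ (coord π (fromℕ d) p)

data IsMaxTree {d n} (π : DPerm d n) : Pred (Fin n) 0ℓ → Tree (Fdir d) → Set₁ where
  emptyT : ∀ {S} → (∀ q → ¬ S q) → IsMaxTree π S leaf
  nodeT  : ∀ {S} {c : Fdir d → Tree (Fdir d)} (p : Fin n) →
           S p →
           (∀ q → S q → lastCoord π q ≤ lastCoord π p) →
           (∀ f → IsMaxTree π (childSet π S p f) (c f)) →
           IsMaxTree π S (node c)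

CompatibleAxis : ∀ {d} → Fin d → Rel (Fdir d) 0ℓ → Set
CompatibleAxis k C = ∀ f₁ f₂ → C f₁ f₂ → entry k f₁ ≡ true → entry k f₂ ≡ false → ⊥

-- Admissibility: at every internal node r (point p, point set S of the
-- sub-permutation rooted at r), for every axis l and f₁ before f₂ in C_l,
-- the points of the nodes of 𝒯_{f₁}(r) (= childSet π S p f₁) have smaller
-- l-th coordinate than those of 𝒯_{f₂}(r) (= childSet π S p f₂).

AdmD : ∀ {d n} {π : DPerm d n} → (Fin d → Rel (Fdir d) 0ℓ) →
       ∀ {S} {T : Tree (Fdir d)} → IsMaxTree {d} {n} π S T → Set
AdmD C (emptyT _) = ⊤
AdmD {d} {n} {π} C {S} (nodeT p _ _ sub) =
  (∀ (l : Fin d) f₁ f₂ → C l f₁ f₂ →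
     ∀ q q' → childSet π S p f₁ q → childSet π S p f₂ q' →
     toℕ (coord π l q) < toℕ (coord π l q'))
  × (∀ f → AdmD {d} {n} {π} C (sub f))

Admissible : ∀ {d n} → (Fin d → Rel (Fdir d) 0ℓ) → DPerm d n → Set₁
Admissible {d} {n} C π = ∀ (T : Tree (Fdir d)) (t : IsMaxTree {d} {n} π Full T) → AdmD {d} {n} {π} C t

{-# OPTIONS --safe #-}
module Submission where

-- Two max-trees of the same shape identify the points of π and π′ node by node.
-- Along every axis l this identification is order preserving: if one of two
-- nodes is an ancestor of the other, the label of the edge leaving the ancestor
-- is the direction between them and so fixes their order on axis l; otherwise
-- they lie in different subtrees f₁ ≠ f₂ of their lowest common ancestor, and
-- admissibility orders them as C_l orders f₁ and f₂.  On axis 0 the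
-- identification is therefore a strictly increasing self-map of [n], i.e. the
-- identity, so equal points sit at equal nodes; on axis l it then follows that
-- π′_l ∘ π_l⁻¹ is strictly increasing, hence the identity.

open import Defs
open import Level using (0ℓ)
open import Data.Nat using (ℕ; _≤_; _<_; _<ᵇ_; zero; suc; z≤n; s<s)
open import Data.Nat.Properties
  using ( ≤-refl; ≤-antisym; ≤-<-trans; <-irrefl; <-asym; ≤⇒≯; ≮⇒≥; ≤∧≢⇒<; ∸-monoʳ-<
        ; <ᵇ⇒<; <⇒<ᵇ; module ≤-Reasoning)
open import Data.Fin as Fin using (Fin; toℕ; fromℕ; inject₁; opposite; _≟_)
open import Data.Fin.Properties
  using (toℕ-injective; toℕ<n; toℕ-inject₁; ≤̄⇒inject₁<; opposite-prop; opposite-involutive)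
open import Data.Fin.Permutation using (Permutation′; _⟨$⟩ʳ_; _⟨$⟩ˡ_; inverseˡ; inverseʳ)
open import Data.Vec using (_∷_; _∷ʳ_; lookup; tabulate)
open import Data.Vec.Properties using (lookup∘tabulate; tabulate-cong)
open import Data.Bool using (Bool; true; false; T)
open import Data.Bool.Properties using (T-≡; ¬-not)
open import Data.Unit using (tt)
open import Data.Empty using (⊥; ⊥-elim)
open import Data.Product using (_×_; _,_; proj₁; proj₂; ∃-syntax)
open import Data.Sum using (_⊎_; inj₁; inj₂)
open import Function using (_∘_; _on_; Equivalence; Injection)
open import Function.Properties.Inverse using (↔⇒↣)
open import Relation.Nullary using (¬_; yes; no)
open import Relation.Unary using (Pred)
open import Relation.Binary.Core using (Rel; _Preserves_⟶_)
open import Relation.Binary.Structures using (IsStrictTotalOrder)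
open import Relation.Binary.Definitions using (Trichotomous; tri<; tri≈; tri>)
open import Relation.Binary.PropositionalEquality
  using (_≡_; _≢_; refl; sym; trans; cong; subst; subst₂; module ≡-Reasoning)

strictMono⇒≤ : ∀ {n} (f : Fin n → ℕ) → f Preserves Fin._<_ ⟶ _<_ → ∀ i → toℕ i ≤ f i
strictMono⇒≤ f mono Fin.zero    = z≤n
strictMono⇒≤ f mono (Fin.suc i) =
  ≤-<-trans (strictMono⇒≤ (f ∘ inject₁) mono-inject₁ i) (mono (≤̄⇒inject₁< ≤-refl))
  where
  mono-inject₁ : (f ∘ inject₁) Preserves Fin._<_ ⟶ _<_
  mono-inject₁ {x} {y} = mono ∘ subst₂ _<_ (sym (toℕ-inject₁ x)) (sym (toℕ-inject₁ y))

opposite-< : ∀ {n} {i j : Fin n} → i Fin.< j → opposite j Fin.< opposite i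
opposite-< {i = i} {j} i<j =
  subst₂ _<_ (sym (opposite-prop j)) (sym (opposite-prop i)) (∸-monoʳ-< (s<s i<j) (toℕ<n j))

strictMono⇒≡id : ∀ {n} (f : Fin n → Fin n) → f Preserves Fin._<_ ⟶ Fin._<_ → ∀ i → f i ≡ i
strictMono⇒≡id f mono i = toℕ-injective (≤-antisym f[i]≤i (strictMono⇒≤ (toℕ ∘ f) mono i))
  where
  f[i]≤i : f i Fin.≤ i
  f[i]≤i = ≮⇒≥ λ i<f[i] → <-irrefl refl (begin-strict
    toℕ (opposite i)
      ≤⟨ strictMono⇒≤ (toℕ ∘ opposite ∘ f ∘ opposite) (opposite-< ∘ mono ∘ opposite-<) (opposite i) ⟩
    toℕ (opposite (f (opposite (opposite i))))
      ≡⟨ cong (toℕ ∘ opposite ∘ f) (opposite-involutive i) ⟩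
    toℕ (opposite (f i))
      <⟨ opposite-< i<f[i] ⟩
    toℕ (opposite i)
      ∎)
    where open ≤-Reasoning

preserves-<⇒≗ : ∀ {n} (σ : Permutation′ n) (g : Fin n → Fin n) →
  g Preserves (Fin._<_ on (σ ⟨$⟩ʳ_)) ⟶ Fin._<_ → ∀ x → g x ≡ σ ⟨$⟩ʳ x
preserves-<⇒≗ σ g mono x = begin
  g x                           ≡⟨ cong g (inverseˡ σ) ⟨
  g (σ ⟨$⟩ˡ (σ ⟨$⟩ʳ x))         ≡⟨ strictMono⇒≡id (g ∘ (σ ⟨$⟩ˡ_)) mono-g∘σ⁻¹ (σ ⟨$⟩ʳ x) ⟩
  σ ⟨$⟩ʳ x                      ∎
  where
  open ≡-Reasoning
  mono-g∘σ⁻¹ : (g ∘ (σ ⟨$⟩ˡ_)) Preserves Fin._<_ ⟶ Fin._<_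
  mono-g∘σ⁻¹ = mono ∘ subst₂ Fin._<_ (sym (inverseʳ σ)) (sym (inverseʳ σ))

<ᵇ-false : ∀ {m n} → ¬ m < n → (m <ᵇ n) ≡ false
<ᵇ-false {m} {n} m≮n = ¬-not {y = true} (m≮n ∘ <ᵇ⇒< m n ∘ Equivalence.from T-≡)

tabulate-∷ʳ : ∀ {A : Set} m (g : Fin (suc m) → A) →
  tabulate g ≡ tabulate (g ∘ inject₁) ∷ʳ g (fromℕ m)
tabulate-∷ʳ zero    g = refl
tabulate-∷ʳ (suc m) g = cong (g Fin.zero ∷_) (tabulate-∷ʳ m (g ∘ Fin.suc))

coord-injective : ∀ {d n} (π : DPerm d n) l {p q} → coord π l p ≡ coord π l q → p ≡ q
coord-injective {suc d} π Fin.zero    = λ p≡q → p≡q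
coord-injective {suc d} π (Fin.suc l) = Injection.injective (↔⇒↣ (perm π l))

dir-<ᵇ : ∀ {d n} (π : DPerm d n) {p q} {f : Fdir d} → dir π p q ≡ toDir f →
  ∀ l → (toℕ (coord π l p) <ᵇ toℕ (coord π l q)) ≡ entry l f
dir-<ᵇ π dir≡f l = trans (sym (lookup∘tabulate _ l)) (cong (λ v → lookup v l) dir≡f)

module _ {d n} {π π′ : DPerm d n} {p q p′ q′} {f : Fdir d}
         (dir≡f : dir π p q ≡ toDir f) (dir′≡f : dir π′ p′ q′ ≡ toDir f) (l : Fin d) where

  private
    same-<ᵇ : (toℕ (coord π l p) <ᵇ toℕ (coord π l q))
            ≡ (toℕ (coord π′ l p′) <ᵇ toℕ (coord π′ l q′))
    same-<ᵇ = trans (dir-<ᵇ π dir≡f l) (sym (dir-<ᵇ π′ dir′≡f l))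

  root<child-transfer : coord π l p Fin.< coord π l q → coord π′ l p′ Fin.< coord π′ l q′
  root<child-transfer = <ᵇ⇒< _ _ ∘ subst T same-<ᵇ ∘ <⇒<ᵇ

  child<root-transfer : q′ ≢ p′ → coord π l q Fin.< coord π l p → coord π′ l q′ Fin.< coord π′ l p′
  child<root-transfer q′≢p′ q<p = ≤∧≢⇒< (≮⇒≥ p′≮q′) (q′≢p′ ∘ coord-injective π′ l ∘ toℕ-injective)
    where
    p′≮q′ : ¬ coord π′ l p′ Fin.< coord π′ l q′
    p′≮q′ = <-asym q<p ∘ <ᵇ⇒< _ _ ∘ subst T (sym same-<ᵇ) ∘ <⇒<ᵇ

childLabel : ∀ {d n} → DPerm (suc d) n → Fin n → Fin n → Fdir (suc d)
childLabel π p q = fdir (tabulate (lookup (dir π p q) ∘ inject₁))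

∈-childSet : ∀ {d n} (π : DPerm (suc d) n) {S : Pred (Fin n) 0ℓ} {p q} →
  S q → q ≢ p → lastCoord π q ≤ lastCoord π p → childSet π S p (childLabel π p q) q
∈-childSet {d} π {p = p} {q} q∈S q≢p q≤p = q∈S , q≢p , (begin
  dir π p q
    ≡⟨ tabulate-∷ʳ d g ⟩
  tabulate (g ∘ inject₁) ∷ʳ g (fromℕ d)
    ≡⟨ cong (tabulate (g ∘ inject₁) ∷ʳ_) (<ᵇ-false (≤⇒≯ q≤p)) ⟩
  tabulate (g ∘ inject₁) ∷ʳ false
    ≡⟨ cong (_∷ʳ false) (tabulate-cong λ l → lookup∘tabulate g (inject₁ l)) ⟨
  toDir (childLabel π p q)
    ∎)
  where
  open ≡-Reasoning
  g : Fin (suc d) → Bool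
  g l = toℕ (coord π l p) <ᵇ toℕ (coord π l q)

module _ {d n} {π π′ : DPerm d n} where

  SameNode : ∀ {S S′ T} → IsMaxTree π S T → IsMaxTree π′ S′ T → Fin n → Fin n → Set
  SameNode (emptyT _)        (emptyT _)          q q′ = ⊥
  SameNode (nodeT p _ _ sub) (nodeT p′ _ _ sub′) q q′ =
    (q ≡ p × q′ ≡ p′) ⊎ ∃[ f ] SameNode (sub f) (sub′ f) q q′

  sameNode-∈ : ∀ {S S′ T} (t : IsMaxTree π S T) (t′ : IsMaxTree π′ S′ T) {q q′} →
    SameNode t t′ q q′ → S q × S′ q′
  sameNode-∈ (emptyT _) (emptyT _) ()
  sameNode-∈ (nodeT p p∈S _ _) (nodeT p′ p′∈S′ _ _) (inj₁ (refl , refl)) = p∈S , p′∈S′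
  sameNode-∈ (nodeT p _ _ sub) (nodeT p′ _ _ sub′) (inj₂ (f , q~q′))
    with (q∈ , _) , (q′∈ , _) ← sameNode-∈ (sub f) (sub′ f) q~q′ = q∈ , q′∈

  module _ (C : Fin d → Rel (Fdir d) 0ℓ) (compare : ∀ l → Trichotomous _≡_ (C l)) where

    sameNode-<-transfer : ∀ {S S′ T} (t : IsMaxTree π S T) (t′ : IsMaxTree π′ S′ T) →
      AdmD C t → AdmD C t′ → ∀ l {q r q′ r′} → SameNode t t′ q q′ → SameNode t t′ r r′ →
      coord π l q Fin.< coord π l r → coord π′ l q′ Fin.< coord π′ l r′
    sameNode-<-transfer (emptyT _) (emptyT _) _ _ l ()
    sameNode-<-transfer (nodeT p _ _ sub) (nodeT p′ _ _ sub′) _ _ l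
      (inj₁ (refl , refl)) (inj₁ (refl , refl)) p<p = ⊥-elim (<-irrefl refl p<p)
    sameNode-<-transfer (nodeT p _ _ sub) (nodeT p′ _ _ sub′) _ _ l
      (inj₁ (refl , refl)) (inj₂ (f , r~r′))
      with (_ , _ , dir≡f) , (_ , _ , dir′≡f) ← sameNode-∈ (sub f) (sub′ f) r~r′ =
      root<child-transfer dir≡f dir′≡f l
    sameNode-<-transfer (nodeT p _ _ sub) (nodeT p′ _ _ sub′) _ _ l
      (inj₂ (f , q~q′)) (inj₁ (refl , refl))
      with (_ , _ , dir≡f) , (_ , q′≢p′ , dir′≡f) ← sameNode-∈ (sub f) (sub′ f) q~q′ =
      child<root-transfer dir≡f dir′≡f l q′≢p′
    sameNode-<-transfer (nodeT p _ _ sub) (nodeT p′ _ _ sub′) (adm , adm-sub) (adm′ , adm′-sub) l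
      (inj₂ (f₁ , q~q′)) (inj₂ (f₂ , r~r′)) q<r
      with (q∈ , q′∈) ← sameNode-∈ (sub f₁) (sub′ f₁) q~q′
         | (r∈ , r′∈) ← sameNode-∈ (sub f₂) (sub′ f₂) r~r′
         | compare l f₁ f₂
    ... | tri< f₁<f₂ _ _ = adm′ l f₁ f₂ f₁<f₂ _ _ q′∈ r′∈
    ... | tri> _ _ f₂<f₁ = ⊥-elim (<-asym q<r (adm l f₂ f₁ f₂<f₁ _ _ r∈ q∈))
    ... | tri≈ _ refl _  =
      sameNode-<-transfer (sub f₁) (sub′ f₁) (adm-sub f₁) (adm′-sub f₁) l q~q′ r~r′ q<r

module _ {d n} {π π′ : DPerm (suc d) n} where

  sameNode-partner : ∀ {S S′ T} (t : IsMaxTree π S T) (t′ : IsMaxTree π′ S′ T) {q} →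
    S q → ∃[ q′ ] SameNode t t′ q q′
  sameNode-partner (emptyT S-empty) (emptyT _) q∈S = ⊥-elim (S-empty _ q∈S)
  sameNode-partner {S} (nodeT p _ p-max sub) (nodeT p′ _ _ sub′) {q} q∈S with q ≟ p
  ... | yes q≡p = p′ , inj₁ (q≡p , refl)
  ... | no q≢p
    with q′ , q~q′ ← sameNode-partner (sub (childLabel π p q)) (sub′ (childLabel π p q))
                                       (∈-childSet π {S} q∈S q≢p (p-max q q∈S))
    = q′ , inj₂ (childLabel π p q , q~q′)

  sameNode-diagonal : (C : Fin (suc d) → Rel (Fdir (suc d)) 0ℓ) →
    (compare : ∀ l → Trichotomous _≡_ (C l)) →
    ∀ {T} {t : IsMaxTree π Full T} {t′ : IsMaxTree π′ Full T} →
    AdmD C t → AdmD C t′ → ∀ q → SameNode t t′ q q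
  sameNode-diagonal C compare {t = t} {t′} adm adm′ q =
    subst (SameNode t t′ q) (strictMono⇒≡id partner partner-mono q) (partner-sameNode q)
    where
    partner : Fin n → Fin n
    partner q = proj₁ (sameNode-partner t t′ {q} tt)
    partner-sameNode : ∀ q → SameNode t t′ q (partner q)
    partner-sameNode q = proj₂ (sameNode-partner t t′ tt)
    partner-mono : partner Preserves Fin._<_ ⟶ Fin._<_
    partner-mono =
      sameNode-<-transfer C compare t t′ adm adm′ Fin.zero (partner-sameNode _) (partner-sameNode _)

lemma2 : (d n : ℕ) → 2 ≤ d →
    (T : Tree (Fdir d)) → size T ≡ n →
    (C : Fin d → Rel (Fdir d) 0ℓ) →
    (∀ k → IsStrictTotalOrder _≡_ (C k)) →
    (∀ k → CompatibleAxis k (C k)) →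
    (π π′ : DPerm d n) →
    Admissible C π → IsMaxTree π Full T →
    Admissible C π′ → IsMaxTree π′ Full T →
    ∀ l i → perm π l ⟨$⟩ʳ i ≡ perm π′ l ⟨$⟩ʳ i
lemma2 zero _ ()
lemma2 (suc d) _ _ T _ C C-sto _ π π′ adm t adm′ t′ l i =
  sym (preserves-<⇒≗ (perm π l) (perm π′ l ⟨$⟩ʳ_) π′ₗ-mono i)
  where
  compare : ∀ k → Trichotomous _≡_ (C k)
  compare k = IsStrictTotalOrder.compare (C-sto k)
  diagonal : ∀ q → SameNode t t′ q q
  diagonal = sameNode-diagonal C compare (adm T t) (adm′ T t′)
  π′ₗ-mono : (perm π′ l ⟨$⟩ʳ_) Preserves (Fin._<_ on (perm π l ⟨$⟩ʳ_)) ⟶ Fin._<_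
  π′ₗ-mono =
    sameNode-<-transfer C compare t t′ (adm T t) (adm′ T t′) (Fin.suc l) (diagonal _) (diagonal _)
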